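{- Let $x$ be a Hall number and let $s \in \mathbb{N}$ satisfy $1 \le s < \frac{1}{5}x^{1/6}$. Then neither $x+s$ nor $x-s$ is a Hall number.
   Context: For a positive integer $x$ that is not a perfect square, let $k_x$ denote the distance between $x^3$ and the perfect square (square of an integer) closest to $x^3$, and let $r_x = \sqrt{x}/k_x$. A Hall number is a positive integer $x$ that is not a perfect square and satisfies $r_x > 1$. -}

module Defs where

open import Data.Nat using (ℕ; _+_; _*_; _^_; _<_; _≤_; ∣_-_∣)
open import Data.Product using (∃; _×_)
open import Relation.Nullary using (¬_)
open import Relation.Binary.PropositionalEquality using (_≡_)

-- n is a perfect square (square of an integer; integer squares = natural squares)
IsSquare : ℕ → Set
IsSquare n = ∃ λ m → m * m ≡ n

IsSqDist : ℕ → ℕ → Set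
IsSqDist x k = (∃ λ m → ∣ x ^ 3 - m * m ∣ ≡ k) × (∀ n → k ≤ ∣ x ^ 3 - n * n ∣)

-- Hall number: x positive, not a perfect square, and r_x = √x / k_x > 1,
-- i.e. (since k_x > 0) √x > k_x, i.e. k_x² < x.
IsHall : ℕ → Set
IsHall x = (0 < x) × ¬ IsSquare x × (∀ k → IsSqDist x k → k * k < x)

module Submission where

-- If x and y = x + s are Hall numbers, write x³ = m² + e and y³ = n² + f with e² < x and
-- f² < y.  The integer Q = 16x³ + 24x²s + 6xs² − s³ − 8(e + f), the expansion of
-- 16 √((x³ − e)(y³ − f)) truncated to a polynomial, satisfies Q² − (16mn)² = R = D T + s² W
-- for explicit polynomials D, T, W.  When (5s)⁶ < y we get |R| < |Q|, and a difference of
-- two squares that is smaller than one of the roots vanishes, so R = 0.  Comparing sizes in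
-- R = D T + s² W and then in W = 288 x (e + f) + s V gives D = 0, W = 0 and e + f = 0, while
-- 324 s⁴ is an integer combination of W, e + f and D.  For x − s use the pair (x − s, x).

open import Defs
open import Data.Nat as ℕ using (ℕ; zero; suc; _≤_; _<_; NonZero; >-nonZero; ≢-nonZero⁻¹)
open import Data.Integer as ℤ using (ℤ; +_; 0ℤ; ∣_∣; _⊖_)
open import Data.Integer.Properties using (abs-*; ∣i+j∣≤∣i∣+∣j∣; ∣i-j∣≤∣i∣+∣j∣; i*j≢0)
import Data.Integer.Properties as ℤᴾ
open import Data.List.Base using (_∷_; [])
open import Data.Product using (∃; ∃₂; _×_; _,_; proj₁; proj₂)
open import Data.Empty using (⊥)
open import Relation.Binary.PropositionalEquality
open import Relation.Nullary using (¬_; yes; no; contradiction)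

module _ where
  open import Data.Nat using (_+_; _*_; _^_; _∸_; _<?_; ∣_-_∣)
  open import Data.Nat.Properties
  open import Data.List.Base using (upTo)
  open import Data.List.Extrema.Nat using (argmin; f[argmin]≤f[⊤]; f[argmin]≤f[xs])
  open import Data.List.Membership.Propositional.Properties using (∈-upTo⁺)
  import Data.List.Relation.Unary.All as All

  minimum-exists : ∀ (f : ℕ → ℕ) N → (∀ n → N ≤ n → f 0 ≤ f n) → ∃ λ m → ∀ n → f m ≤ f n
  minimum-exists f N beyond = argmin f 0 (upTo N) , minimal
    where
    minimal : ∀ n → f (argmin f 0 (upTo N)) ≤ f n
    minimal n with n <? N
    ... | yes n<N = All.lookup (f[argmin]≤f[xs] {f = f} 0 (upTo N)) (∈-upTo⁺ n<N)
    ... | no  n≮N = ≤-trans (f[argmin]≤f[⊤] {f = f} 0 (upTo N)) (beyond n (≮⇒≥ n≮N))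

  sqDist-exists : ∀ x → ∃ (IsSqDist x)
  sqDist-exists x = dist (proj₁ closest) , (proj₁ closest , refl) , proj₂ closest
    where
    dist : ℕ → ℕ
    dist n = ∣ x ^ 3 - n * n ∣
    far : ∀ n → suc (x ^ 3 + x ^ 3) ≤ n → dist 0 ≤ dist n
    far (suc n) 2x³<n = begin
      ∣ x ^ 3 - 0 ∣               ≡⟨ ∣-∣-identityʳ (x ^ 3) ⟩
      x ^ 3                       ≤⟨ m+n≤o⇒m≤o∸n (x ^ 3) 2x³≤n² ⟩
      suc n * suc n ∸ x ^ 3       ≤⟨ m∸n≤∣m-n∣ (suc n * suc n) (x ^ 3) ⟩
      ∣ suc n * suc n - x ^ 3 ∣   ≡⟨ ∣-∣-comm (suc n * suc n) (x ^ 3) ⟩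
      dist (suc n)                ∎
      where
      open ≤-Reasoning
      2x³≤n² : x ^ 3 + x ^ 3 ≤ suc n * suc n
      2x³≤n² = ≤-trans (≤-pred 2x³<n) (≤-trans (n≤1+n n) (m≤m*n (suc n) (suc n)))
    closest : ∃ λ m → ∀ n → dist m ≤ dist n
    closest = minimum-exists dist (suc (x ^ 3 + x ^ 3)) far

module _ where
  open import Data.Nat using (_+_; _*_)
  open import Data.Nat.Properties
  open import Data.Nat.Tactic.RingSolver using (solve)

  m*m≤n*n⇒m≤n : ∀ {m n} → m * m ≤ n * n → m ≤ n
  m*m≤n*n⇒m≤n m²≤n² = ≮⇒≥ λ n<m → <⇒≱ (*-mono-< n<m n<m) m²≤n²

  module Powers {s : ℕ} (1≤s : 1 ≤ s) where
    instance
      s≢0 : NonZero s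
      s≢0 = >-nonZero 1≤s

    s⁴≤s⁶ : s * s * s * s ≤ s * s * s * s * s * s
    s⁴≤s⁶ = ≤-trans (m≤m*n (s * s * s * s) s) (m≤m*n (s * s * s * s * s) s)

    s³≤s⁶ : s * s * s ≤ s * s * s * s * s * s
    s³≤s⁶ = ≤-trans (m≤m*n (s * s * s) s) s⁴≤s⁶

    s²≤s⁶ : s * s ≤ s * s * s * s * s * s
    s²≤s⁶ = ≤-trans (m≤m*n (s * s) s) s³≤s⁶

    s≤s⁶ : s ≤ s * s * s * s * s * s
    s≤s⁶ = ≤-trans (m≤m*n s s) s²≤s⁶

  -- Each estimate is multiplied by 50, so that every term acquires a factor 50 (s A), 50 A or
  -- 50 sᵏ, each of which is at most x.
  module Estimates {x s : ℕ} (1≤s : 1 ≤ s) (s⁶-small : 15624 * (s * s * s * s * s * s) ≤ x) where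
    open Powers 1≤s
    open ≤-Reasoning

    c*t≤x : ∀ {c t} → c ≤ 15624 → t ≤ s * s * s * s * s * s → c * t ≤ x
    c*t≤x c≤ t≤s⁶ = ≤-trans (*-mono-≤ c≤ t≤s⁶) s⁶-small

    50≤15624 : 50 ≤ 15624
    50≤15624 = ≤ᵇ⇒≤ 50 15624 _

    1≤x : 1 ≤ x
    1≤x = ≤-trans 1≤s (≤-trans (m≤n*m s 50) (c*t≤x 50≤15624 s≤s⁶))

    private instance
      x≢0 : NonZero x
      x≢0 = >-nonZero 1≤x
      x+s≢0 : NonZero (x + s)
      x+s≢0 = >-nonZero (≤-trans 1≤x (m≤m+n x s))

    100sa≤x : ∀ {a} → a * a < x + s → 100 * s * a ≤ x
    100sa≤x {a} a²<x+s = m*m≤n*n⇒m≤n (begin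
      100 * s * a * (100 * s * a)               ≡⟨ solve (s ∷ a ∷ []) ⟩
      10000 * (s * s) * (a * a)                 ≤⟨ *-monoʳ-≤ (10000 * (s * s)) (<⇒≤ a²<x+s) ⟩
      10000 * (s * s) * (x + s)                 ≡⟨ solve (x ∷ s ∷ []) ⟩
      10000 * (s * s) * x + s * s * (10000 * s) ≤⟨ +-monoʳ-≤ (10000 * (s * s) * x) (*-monoʳ-≤ (s * s) 10000s≤5624x) ⟩
      10000 * (s * s) * x + s * s * (5624 * x)  ≡⟨ solve (x ∷ s ∷ []) ⟩
      15624 * (s * s) * x                       ≤⟨ *-monoˡ-≤ x (c*t≤x ≤-refl s²≤s⁶) ⟩
      x * x                                     ∎)
      where
      10000s≤5624x : 10000 * s ≤ 5624 * x
      10000s≤5624x = ≤-trans (*-monoˡ-≤ s (≤ᵇ⇒≤ 10000 15624 _)) (≤-trans (c*t≤x ≤-refl s≤s⁶) (m≤n*m x 5624))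

    50s[a+b]≤x : ∀ {a b} → a * a < x → b * b < x + s → 50 * (s * (a + b)) ≤ x
    50s[a+b]≤x {a} {b} a²<x b²<x+s = *-cancelˡ-≤ 2 (begin
      2 * (50 * (s * (a + b)))   ≡⟨ solve (s ∷ a ∷ b ∷ []) ⟩
      100 * s * a + 100 * s * b  ≤⟨ +-mono-≤ (100sa≤x (<-≤-trans a²<x (m≤m+n x s))) (100sa≤x b²<x+s) ⟩
      x + x                      ≡⟨ solve (x ∷ []) ⟩
      2 * x                      ∎)

    module _ {A : ℕ} (50sA≤x : 50 * (s * A) ≤ x) where

      50A≤x : 50 * A ≤ x
      50A≤x = ≤-trans (*-monoʳ-≤ 50 (m≤n*m A s)) 50sA≤x

      sV-estimate : s * (274 * A + s * s * s) < 288 * x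
      sV-estimate = *-cancelˡ-< 50 _ _ (begin-strict
        50 * (s * (274 * A + s * s * s))             ≡⟨ solve (s ∷ A ∷ []) ⟩
        274 * (50 * (s * A)) + 50 * (s * s * s * s)  ≤⟨ +-mono-≤ (*-monoʳ-≤ 274 50sA≤x) (c*t≤x 50≤15624 s⁴≤s⁶) ⟩
        274 * x + x                                  ≡⟨ solve (x ∷ []) ⟩
        275 * x                                      <⟨ *-monoˡ-< x (≤ᵇ⇒≤ 276 14400 _) ⟩
        14400 * x                                    ≡⟨ *-assoc 50 288 x ⟩
        50 * (288 * x)                               ∎)

      s²W-estimate : s * s * (A * (288 * x) + s * (274 * A + s * s * s)) + 2 * A < 12 * (s * x * (x + s))
      s²W-estimate = *-cancelˡ-< 50 _ _ (begin-strict
        50 * (s * s * (A * (288 * x) + s * (274 * A + s * s * s)) + 2 * A)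
          ≡⟨ solve (x ∷ s ∷ A ∷ []) ⟩
        288 * (x * s * (50 * (s * A))) + 274 * (s * s * (50 * (s * A)))
          + 50 * (s * s * s * s * s * s) + 2 * (50 * A)
          ≤⟨ +-mono-≤ (+-mono-≤ (+-mono-≤ (*-monoʳ-≤ 288 (*-monoʳ-≤ (x * s) 50sA≤x))
                                           (*-monoʳ-≤ 274 (*-monoʳ-≤ (s * s) 50sA≤x)))
                                (c*t≤x 50≤15624 ≤-refl))
                      (*-monoʳ-≤ 2 50A≤x) ⟩
        288 * (x * s * x) + 274 * (s * s * x) + x + 2 * x
          ≤⟨ +-mono-≤ (+-mono-≤ (+-mono-≤ (*-monoʳ-≤ 288 xsx≤Y) (*-monoʳ-≤ 274 ssx≤Y)) x≤Y) (*-monoʳ-≤ 2 x≤Y) ⟩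
        288 * Y + 274 * Y + Y + 2 * Y  ≡⟨ collect Y ⟩
        565 * Y                        <⟨ *-monoˡ-< Y {{>-nonZero (≤-trans 1≤x x≤Y)}} (≤ᵇ⇒≤ 566 600 _) ⟩
        600 * Y                        ≡⟨ *-assoc 50 12 Y ⟩
        50 * (12 * Y)                  ∎)
        where
        Y = s * x * (x + s)
        collect : ∀ t → 288 * t + 274 * t + t + 2 * t ≡ 565 * t
        collect t = solve (t ∷ [])
        xsx≤Y : x * s * x ≤ Y
        xsx≤Y = begin x * s * x ≡⟨ solve (x ∷ s ∷ []) ⟩ s * x * x ≤⟨ *-monoʳ-≤ (s * x) (m≤m+n x s) ⟩ Y ∎
        ssx≤Y : s * s * x ≤ Y
        ssx≤Y = begin s * s * x ≡⟨ solve (x ∷ s ∷ []) ⟩ s * x * s ≤⟨ *-monoʳ-≤ (s * x) (m≤n+m s x) ⟩ Y ∎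
        x≤Y : x ≤ Y
        x≤Y = ≤-trans (m≤n*m x s) (m≤m*n (s * x) (x + s))

      residual-estimate :
        (32 * A + s * s * s) * (12 * (s * x * (x + s)) + 2 * A) + 12 * (s * x * (x + s))
          + (8 * (x * x * s) + 6 * (x * s * s) + s * s * s + 8 * A)
        ≤ 16 * (x * x * (x + s))
      residual-estimate = *-cancelˡ-≤ 50 (begin
        50 * ((32 * A + s * s * s) * (12 * (s * x * (x + s)) + 2 * A) + 12 * (s * x * (x + s))
             + (8 * (x * x * s) + 6 * (x * s * s) + s * s * s + 8 * A))
          ≡⟨ solve (x ∷ s ∷ A ∷ []) ⟩
        12 * (x * (x + s)) * (32 * (50 * (s * A)) + 50 * (s * s * s * s) + 50 * s)
          + 2 * (50 * A) * (32 * A + s * s * s)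
          + 8 * (x * x) * (50 * s) + 6 * x * (50 * (s * s)) + 50 * (s * s * s) + 8 * (50 * A)
          ≤⟨ +-mono-≤ (+-mono-≤ (+-mono-≤ (+-mono-≤ (+-mono-≤
               (*-monoʳ-≤ (12 * (x * (x + s)))
                 (+-mono-≤ (+-mono-≤ (*-monoʳ-≤ 32 50sA≤x) (c*t≤x 50≤15624 s⁴≤s⁶)) (c*t≤x 50≤15624 s≤s⁶)))
               (*-mono-≤ (*-monoʳ-≤ 2 50A≤x) (+-mono-≤ 32A≤x s³≤x)))
               (*-monoʳ-≤ (8 * (x * x)) (c*t≤x 50≤15624 s≤s⁶)))
               (*-monoʳ-≤ (6 * x) (c*t≤x 50≤15624 s²≤s⁶)))
               (c*t≤x 50≤15624 s³≤s⁶))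
               (*-monoʳ-≤ 8 50A≤x) ⟩
        12 * (x * (x + s)) * (32 * x + x + x) + 2 * x * (x + x)
          + 8 * (x * x) * x + 6 * x * x + x + 8 * x
          ≡⟨ solve (x ∷ s ∷ []) ⟩
        408 * (x * x * (x + s)) + 8 * (x * x * x) + 10 * (x * x) + 9 * x
          ≤⟨ +-mono-≤ (+-mono-≤ (+-monoʳ-≤ (408 * (x * x * (x + s))) (*-monoʳ-≤ 8 x³≤Z)) (*-monoʳ-≤ 10 x²≤Z)) (*-monoʳ-≤ 9 x≤Z) ⟩
        408 * (x * x * (x + s)) + 8 * (x * x * (x + s)) + 10 * (x * x * (x + s)) + 9 * (x * x * (x + s))
          ≡⟨ solve (x ∷ s ∷ []) ⟩
        435 * (x * x * (x + s))        ≤⟨ *-monoˡ-≤ (x * x * (x + s)) (≤ᵇ⇒≤ 435 800 _) ⟩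
        800 * (x * x * (x + s))        ≡⟨ *-assoc 50 16 (x * x * (x + s)) ⟩
        50 * (16 * (x * x * (x + s)))  ∎)
        where
        Z = x * x * (x + s)
        32A≤x : 32 * A ≤ x
        32A≤x = ≤-trans (*-monoˡ-≤ A (≤ᵇ⇒≤ 32 50 _)) 50A≤x
        s³≤x : s * s * s ≤ x
        s³≤x = ≤-trans (m≤n*m (s * s * s) 50) (c*t≤x 50≤15624 s³≤s⁶)
        x²≤Z : x * x ≤ Z
        x²≤Z = m≤m*n (x * x) (x + s)
        x³≤Z : x * x * x ≤ Z
        x³≤Z = *-monoʳ-≤ (x * x) (m≤m+n x s)
        x≤Z : x ≤ Z
        x≤Z = ≤-trans (m≤m*n x x) x²≤Z

module _ where
  open import Data.Integer using (_+_; _-_; _*_; -_)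
  open import Data.Integer.Properties
  open import Data.Integer.Tactic.RingSolver using (solve-∀)
  open import Algebra.Properties.AbelianGroup +-0-abelianGroup using (inverseˡ-unique)
  open import Function using (_∘_)
  import Data.Nat.Properties as ℕP

  ∣m⊖n∣≡∣m-n∣ : ∀ m n → ∣ m ⊖ n ∣ ≡ ℕ.∣ m - n ∣
  ∣m⊖n∣≡∣m-n∣ zero    zero    = refl
  ∣m⊖n∣≡∣m-n∣ zero    (suc n) = refl
  ∣m⊖n∣≡∣m-n∣ (suc m) zero    = refl
  ∣m⊖n∣≡∣m-n∣ (suc m) (suc n) = trans (cong ∣_∣ ([1+m]⊖[1+n]≡m⊖n m n)) (∣m⊖n∣≡∣m-n∣ m n)

  pos-cube : ∀ n → + (n ℕ.^ 3) ≡ + n * + n * + n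
  pos-cube n = trans (pos-* n _) (trans (cong (+ n *_) (trans (pos-* n _) (cong (+ n *_) (pos-* n 1)))) (reassociate (+ n)))
    where
    reassociate : ∀ i → i * (i * (i * + 1)) ≡ i * i * i
    reassociate = solve-∀

  ∣+m*+n*+o∣ : ∀ m n o → ∣ + m * + n * + o ∣ ≡ m ℕ.* n ℕ.* o
  ∣+m*+n*+o∣ m n o = trans (abs-* (+ m * + n) (+ o)) (cong (ℕ._* o) (abs-* (+ m) (+ n)))

  ∣i∣≤∣i+j∣+∣j∣ : ∀ i j → ∣ i ∣ ≤ ∣ i + j ∣ ℕ.+ ∣ j ∣
  ∣i∣≤∣i+j∣+∣j∣ i j = subst (λ k → ∣ k ∣ ≤ ∣ i + j ∣ ℕ.+ ∣ j ∣) (i+j-j≡i i j) (∣i-j∣≤∣i∣+∣j∣ (i + j) j)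
    where
    i+j-j≡i : ∀ i j → i + j - j ≡ i
    i+j-j≡i = solve-∀

  ∣j∣≤∣i*j∣ : ∀ i j → i ≢ 0ℤ → ∣ j ∣ ≤ ∣ i * j ∣
  ∣j∣≤∣i*j∣ i j i≢0 = ℕP.≤-trans (ℕP.m≤n*m ∣ j ∣ ∣ i ∣ {{ℕ.≢-nonZero (i≢0 ∘ ∣i∣≡0⇒i≡0)}}) (ℕP.≤-reflexive (sym (abs-* i j)))

  i*j+k≡0⇒i≡0 : ∀ i j k → i * j + k ≡ 0ℤ → ∣ k ∣ < ∣ j ∣ → i ≡ 0ℤ
  i*j+k≡0⇒i≡0 i j k ij+k≡0 ∣k∣<∣j∣ with i ≟ 0ℤ
  ... | yes i≡0 = i≡0
  ... | no  i≢0 = contradiction (begin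
    ∣ j ∣     ≤⟨ ∣j∣≤∣i*j∣ i j i≢0 ⟩
    ∣ i * j ∣ ≡⟨ cong ∣_∣ (inverseˡ-unique (i * j) k ij+k≡0) ⟩
    ∣ - k ∣   ≡⟨ ∣-i∣≡∣i∣ k ⟩
    ∣ k ∣     ∎) (ℕP.<⇒≱ ∣k∣<∣j∣)
    where
    open ℕP.≤-Reasoning

  -- If c = (i − j)(i + j) ≠ 0, each factor is at most |c| in absolute value,
  -- so 2|i| = |(i + j) + (i − j)| ≤ 2|c|.
  ∣i*i-j*j∣<∣i∣⇒i*i-j*j≡0 : ∀ i j → ∣ i * i - j * j ∣ < ∣ i ∣ → i * i - j * j ≡ 0ℤ
  ∣i*i-j*j∣<∣i∣⇒i*i-j*j≡0 i j c<∣i∣ with i * i - j * j ≟ 0ℤ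
  ... | yes c≡0 = c≡0
  ... | no  c≢0 = contradiction (ℕP.*-cancelˡ-≤ 2 (begin
    2 ℕ.* ∣ i ∣               ≡⟨ abs-* (+ 2) i ⟨
    ∣ + 2 * i ∣               ≡⟨ cong ∣_∣ (sum-of-factors i j) ⟩
    ∣ (i + j) + (i - j) ∣     ≤⟨ ∣i+j∣≤∣i∣+∣j∣ (i + j) (i - j) ⟩
    ∣ i + j ∣ ℕ.+ ∣ i - j ∣   ≤⟨ ℕP.+-mono-≤ ∣i+j∣≤∣c∣ ∣i-j∣≤∣c∣ ⟩
    ∣ c ∣ ℕ.+ ∣ c ∣           ≡⟨ cong (∣ c ∣ ℕ.+_) (ℕP.+-identityʳ ∣ c ∣) ⟨
    2 ℕ.* ∣ c ∣               ∎)) (ℕP.<⇒≱ c<∣i∣)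
    where
    open ℕP.≤-Reasoning
    c = i * i - j * j
    factors : ∀ i j → i * i - j * j ≡ (i - j) * (i + j)
    factors = solve-∀
    sum-of-factors : ∀ i j → + 2 * i ≡ (i + j) + (i - j)
    sum-of-factors = solve-∀
    i-j≢0 : i - j ≢ 0ℤ
    i-j≢0 i-j≡0 = c≢0 (trans (factors i j) (trans (cong (_* (i + j)) i-j≡0) (*-zeroˡ (i + j))))
    i+j≢0 : i + j ≢ 0ℤ
    i+j≢0 i+j≡0 = c≢0 (trans (factors i j) (trans (cong ((i - j) *_) i+j≡0) (*-zeroʳ (i - j))))
    ∣i+j∣≤∣c∣ : ∣ i + j ∣ ≤ ∣ c ∣
    ∣i+j∣≤∣c∣ = ℕP.≤-trans (∣j∣≤∣i*j∣ (i - j) (i + j) i-j≢0) (ℕP.≤-reflexive (cong ∣_∣ (sym (factors i j))))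
    ∣i-j∣≤∣c∣ : ∣ i - j ∣ ≤ ∣ c ∣
    ∣i-j∣≤∣c∣ = ℕP.≤-trans (∣j∣≤∣i*j∣ (i + j) (i - j) i+j≢0)
                           (ℕP.≤-reflexive (cong ∣_∣ (sym (trans (factors i j) (*-comm (i - j) (i + j))))))

  CubeNearSquare : ℕ → Set
  CubeNearSquare x = ∃₂ λ (m : ℕ) (e : ℤ) → ∣ e ∣ ℕ.* ∣ e ∣ < x × + m * + m ≡ + x * + x * + x - e

  Hall⇒cube-near-square : ∀ {x} → IsHall x → CubeNearSquare x
  Hall⇒cube-near-square {x} (_ , _ , small-dist) with sqDist-exists x
  ... | k , (m , ∣x³-m²∣≡k) , minimal =
    m , e , subst (λ j → j ℕ.* j < x) (sym ∣e∣≡k) (small-dist k ((m , ∣x³-m²∣≡k) , minimal)) , m²≡x³-e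
    where
    e = x ℕ.^ 3 ⊖ m ℕ.* m
    ∣e∣≡k : ∣ e ∣ ≡ k
    ∣e∣≡k = trans (∣m⊖n∣≡∣m-n∣ (x ℕ.^ 3) (m ℕ.* m)) ∣x³-m²∣≡k
    cancel : ∀ a b → b ≡ a - (a - b)
    cancel = solve-∀
    m²≡x³-e : + m * + m ≡ + x * + x * + x - e
    m²≡x³-e = begin
      + m * + m                                        ≡⟨ cancel (+ x * + x * + x) (+ m * + m) ⟩
      + x * + x * + x - (+ x * + x * + x - + m * + m)  ≡⟨ cong₂ (λ c d → + x * + x * + x - (c - d)) (pos-cube x) (pos-* m m) ⟨
      + x * + x * + x - (+ (x ℕ.^ 3) - + (m ℕ.* m))    ≡⟨ cong (λ d → + x * + x * + x - d) ([+m]-[+n]≡m⊖n (x ℕ.^ 3) (m ℕ.* m)) ⟩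
      + x * + x * + x - e                              ∎
      where open ≡-Reasoning

module NearCubePair (x s : ℕ) (e f : ℤ) where

  module Terms where
    open import Data.Integer using (_+_; _-_; _*_)
    open import Data.Integer.Tactic.RingSolver using (solve-∀)

    X S Y S³ E δ : ℤ
    X = + x
    S = + s
    Y = X + S
    S³ = S * S * S
    E = e + f
    δ = e - f

    Q₀ Q₁ Qerr Q D T₀ T V₀ V W R : ℤ
    Q₀ = + 16 * (X * X * Y)
    Q₁ = + 8 * (X * X * S) + + 6 * (X * S * S)
    Qerr = Q₁ - S³ - + 8 * E
    Q = Q₀ + Qerr
    D = + 32 * δ - S³
    T₀ = + 12 * (S * X * Y)
    T = T₀ + + 2 * δ
    V₀ = + 274 * e + + 14 * f
    V = V₀ + S³
    W = E * (+ 288 * X) + S * V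
    R = D * T + S * S * W

    R≡Q²-[16M]² : ∀ M → M * M ≡ (X * X * X - e) * (Y * Y * Y - f) → R ≡ Q * Q - + 16 * M * (+ 16 * M)
    R≡Q²-[16M]² M M²≡ = trans (expansion X S e f) (cong (Q * Q -_) (trans (cong (+ 256 *_) (sym M²≡)) (sym (square-16 M))))
      where
      square-16 : ∀ M → + 16 * M * (+ 16 * M) ≡ + 256 * (M * M)
      square-16 = solve-∀
      expansion : ∀ x s e f →
        (+ 32 * (e - f) - s * s * s) * (+ 12 * (s * x * (x + s)) + + 2 * (e - f))
          + s * s * ((e + f) * (+ 288 * x) + s * (+ 274 * e + + 14 * f + s * s * s))
        ≡ (+ 16 * (x * x * (x + s)) + (+ 8 * (x * x * s) + + 6 * (x * s * s) - s * s * s - + 8 * (e + f)))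
          * (+ 16 * (x * x * (x + s)) + (+ 8 * (x * x * s) + + 6 * (x * s * s) - s * s * s - + 8 * (e + f)))
          - + 256 * ((x * x * x - e) * ((x + s) * (x + s) * (x + s) - f))
      expansion = solve-∀

    S²W≡0 : R ≡ 0ℤ → D ≡ 0ℤ → S * S * W ≡ 0ℤ
    S²W≡0 R≡0 D≡0 = trans (sym (trans (cong (λ d → d * T + S * S * W) D≡0) (ℤᴾ.+-identityˡ (S * S * W)))) R≡0

    324s⁴≡0 : W ≡ 0ℤ → E ≡ 0ℤ → D ≡ 0ℤ → + 324 * (S * S * S * S) ≡ 0ℤ
    324s⁴≡0 W≡0 E≡0 D≡0 = begin
      + 324 * (S * S * S * S)               ≡⟨ identity X S e f ⟩
      + 64 * W - c * E - + 260 * S * D      ≡⟨ cong₂ (λ w ε → + 64 * w - c * ε - + 260 * S * D) W≡0 E≡0 ⟩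
      + 64 * 0ℤ - c * 0ℤ - + 260 * S * D    ≡⟨ cong (λ d → + 64 * 0ℤ - c * 0ℤ - + 260 * S * d) D≡0 ⟩
      + 64 * 0ℤ - c * 0ℤ - + 260 * S * 0ℤ   ≡⟨ vanishes c (+ 260 * S) ⟩
      0ℤ                                    ∎
      where
      open ≡-Reasoning
      c = + 18432 * X + + 9216 * S
      identity : ∀ x s e f → + 324 * (s * s * s * s)
        ≡ + 64 * ((e + f) * (+ 288 * x) + s * (+ 274 * e + + 14 * f + s * s * s))
          - (+ 18432 * x + + 9216 * s) * (e + f) - + 260 * s * (+ 32 * (e - f) - s * s * s)
      identity = solve-∀
      vanishes : ∀ a b → + 64 * 0ℤ - a * 0ℤ - b * 0ℤ ≡ 0ℤ
      vanishes = solve-∀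

  open Terms
  open import Data.Nat using (_+_; _*_)
  open import Data.Nat.Properties
  open ≤-Reasoning

  A : ℕ
  A = ∣ e ∣ + ∣ f ∣

  ∣S³∣≡s³ : ∣ S³ ∣ ≡ s * s * s
  ∣S³∣≡s³ = ∣+m*+n*+o∣ s s s

  ∣E∣≤A : ∣ E ∣ ≤ A
  ∣E∣≤A = ∣i+j∣≤∣i∣+∣j∣ e f

  ∣δ∣≤A : ∣ δ ∣ ≤ A
  ∣δ∣≤A = ∣i-j∣≤∣i∣+∣j∣ e f

  ∣2δ∣≤2A : ∣ + 2 ℤ.* δ ∣ ≤ 2 * A
  ∣2δ∣≤2A = ≤-trans (≤-reflexive (abs-* (+ 2) δ)) (*-monoʳ-≤ 2 ∣δ∣≤A)

  ∣D∣≤ : ∣ D ∣ ≤ 32 * A + s * s * s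
  ∣D∣≤ = begin
    ∣ D ∣                    ≤⟨ ∣i-j∣≤∣i∣+∣j∣ (+ 32 ℤ.* δ) S³ ⟩
    ∣ + 32 ℤ.* δ ∣ + ∣ S³ ∣  ≡⟨ cong₂ _+_ (abs-* (+ 32) δ) ∣S³∣≡s³ ⟩
    32 * ∣ δ ∣ + s * s * s   ≤⟨ +-monoˡ-≤ (s * s * s) (*-monoʳ-≤ 32 ∣δ∣≤A) ⟩
    32 * A + s * s * s       ∎

  ∣T₀∣≡ : ∣ T₀ ∣ ≡ 12 * (s * x * (x + s))
  ∣T₀∣≡ = trans (abs-* (+ 12) (S ℤ.* X ℤ.* Y)) (cong (12 *_) (∣+m*+n*+o∣ s x (x + s)))

  ∣T∣≤ : ∣ T ∣ ≤ 12 * (s * x * (x + s)) + 2 * A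
  ∣T∣≤ = ≤-trans (∣i+j∣≤∣i∣+∣j∣ T₀ (+ 2 ℤ.* δ)) (+-mono-≤ (≤-reflexive ∣T₀∣≡) ∣2δ∣≤2A)

  ∣T∣≥ : 12 * (s * x * (x + s)) ≤ ∣ T ∣ + 2 * A
  ∣T∣≥ = begin
    12 * (s * x * (x + s))  ≡⟨ ∣T₀∣≡ ⟨
    ∣ T₀ ∣                  ≤⟨ ∣i∣≤∣i+j∣+∣j∣ T₀ (+ 2 ℤ.* δ) ⟩
    ∣ T ∣ + ∣ + 2 ℤ.* δ ∣    ≤⟨ +-monoʳ-≤ ∣ T ∣ ∣2δ∣≤2A ⟩
    ∣ T ∣ + 2 * A           ∎

  ∣V∣≤ : ∣ V ∣ ≤ 274 * A + s * s * s
  ∣V∣≤ = begin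
    ∣ V ∣                                        ≤⟨ ∣i+j∣≤∣i∣+∣j∣ V₀ S³ ⟩
    ∣ V₀ ∣ + ∣ S³ ∣                              ≤⟨ +-mono-≤ (∣i+j∣≤∣i∣+∣j∣ (+ 274 ℤ.* e) (+ 14 ℤ.* f)) (≤-reflexive ∣S³∣≡s³) ⟩
    ∣ + 274 ℤ.* e ∣ + ∣ + 14 ℤ.* f ∣ + s * s * s  ≡⟨ cong (_+ s * s * s) (cong₂ _+_ (abs-* (+ 274) e) (abs-* (+ 14) f)) ⟩
    274 * ∣ e ∣ + 14 * ∣ f ∣ + s * s * s         ≤⟨ +-monoˡ-≤ (s * s * s) (+-monoʳ-≤ (274 * ∣ e ∣) (*-monoˡ-≤ ∣ f ∣ (≤ᵇ⇒≤ 14 274 _))) ⟩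
    274 * ∣ e ∣ + 274 * ∣ f ∣ + s * s * s        ≡⟨ cong (_+ s * s * s) (*-distribˡ-+ 274 ∣ e ∣ ∣ f ∣) ⟨
    274 * A + s * s * s                          ∎

  ∣SV∣≤ : ∣ S ℤ.* V ∣ ≤ s * (274 * A + s * s * s)
  ∣SV∣≤ = ≤-trans (≤-reflexive (abs-* S V)) (*-monoʳ-≤ s ∣V∣≤)

  ∣S²W∣≤ : ∣ S ℤ.* S ℤ.* W ∣ ≤ s * s * (A * (288 * x) + s * (274 * A + s * s * s))
  ∣S²W∣≤ = begin
    ∣ S ℤ.* S ℤ.* W ∣                               ≡⟨ trans (abs-* (S ℤ.* S) W) (cong (_* ∣ W ∣) (abs-* S S)) ⟩
    s * s * ∣ W ∣                                   ≤⟨ *-monoʳ-≤ (s * s) (∣i+j∣≤∣i∣+∣j∣ (E ℤ.* (+ 288 ℤ.* X)) (S ℤ.* V)) ⟩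
    s * s * (∣ E ℤ.* (+ 288 ℤ.* X) ∣ + ∣ S ℤ.* V ∣)  ≤⟨ *-monoʳ-≤ (s * s) (+-mono-≤ ∣288XE∣≤ ∣SV∣≤) ⟩
    s * s * (A * (288 * x) + s * (274 * A + s * s * s)) ∎
    where
    ∣288XE∣≤ : ∣ E ℤ.* (+ 288 ℤ.* X) ∣ ≤ A * (288 * x)
    ∣288XE∣≤ = ≤-trans (≤-reflexive (trans (abs-* E (+ 288 ℤ.* X)) (cong (∣ E ∣ *_) (abs-* (+ 288) X))))
                       (*-monoˡ-≤ (288 * x) ∣E∣≤A)

  ∣Q∣≥ : 16 * (x * x * (x + s)) ≤ ∣ Q ∣ + ∣ Qerr ∣
  ∣Q∣≥ = ≤-trans (≤-reflexive (sym ∣Q₀∣≡)) (∣i∣≤∣i+j∣+∣j∣ Q₀ Qerr)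
    where
    ∣Q₀∣≡ : ∣ Q₀ ∣ ≡ 16 * (x * x * (x + s))
    ∣Q₀∣≡ = trans (abs-* (+ 16) (X ℤ.* X ℤ.* Y)) (cong (16 *_) (∣+m*+n*+o∣ x x (x + s)))

  ∣Qerr∣≤ : ∣ Qerr ∣ ≤ 8 * (x * x * s) + 6 * (x * s * s) + s * s * s + 8 * A
  ∣Qerr∣≤ = begin
    ∣ Qerr ∣                                                  ≤⟨ ∣i-j∣≤∣i∣+∣j∣ (Q₁ ℤ.- S³) (+ 8 ℤ.* E) ⟩
    ∣ Q₁ ℤ.- S³ ∣ + ∣ + 8 ℤ.* E ∣                              ≤⟨ +-monoˡ-≤ ∣ + 8 ℤ.* E ∣ (∣i-j∣≤∣i∣+∣j∣ Q₁ S³) ⟩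
    ∣ Q₁ ∣ + ∣ S³ ∣ + ∣ + 8 ℤ.* E ∣                            ≤⟨ +-mono-≤ (+-monoˡ-≤ ∣ S³ ∣ ∣Q₁∣≤) ∣8E∣≤ ⟩
    8 * (x * x * s) + 6 * (x * s * s) + ∣ S³ ∣ + 8 * A         ≡⟨ cong (λ n → 8 * (x * x * s) + 6 * (x * s * s) + n + 8 * A) ∣S³∣≡s³ ⟩
    8 * (x * x * s) + 6 * (x * s * s) + s * s * s + 8 * A      ∎
    where
    ∣Q₁∣≤ : ∣ Q₁ ∣ ≤ 8 * (x * x * s) + 6 * (x * s * s)
    ∣Q₁∣≤ = ≤-trans (∣i+j∣≤∣i∣+∣j∣ (+ 8 ℤ.* (X ℤ.* X ℤ.* S)) (+ 6 ℤ.* (X ℤ.* S ℤ.* S)))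
                    (≤-reflexive (cong₂ _+_ (trans (abs-* (+ 8) (X ℤ.* X ℤ.* S)) (cong (8 *_) (∣+m*+n*+o∣ x x s)))
                                            (trans (abs-* (+ 6) (X ℤ.* S ℤ.* S)) (cong (6 *_) (∣+m*+n*+o∣ x s s)))))
    ∣8E∣≤ : ∣ + 8 ℤ.* E ∣ ≤ 8 * A
    ∣8E∣≤ = ≤-trans (≤-reflexive (abs-* (+ 8) E)) (*-monoʳ-≤ 8 ∣E∣≤A)

  module _ (1≤s : 1 ≤ s) (s⁶-small : 15624 * (s * s * s * s * s * s) ≤ x)
           (e²<x : ∣ e ∣ * ∣ e ∣ < x) (f²<x+s : ∣ f ∣ * ∣ f ∣ < x + s) where
    open Estimates 1≤s s⁶-small
    open Powers 1≤s using (s≢0)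

    50sA≤x : 50 * (s * A) ≤ x
    50sA≤x = 50s[a+b]≤x {∣ e ∣} {∣ f ∣} e²<x f²<x+s

    ∣S²W∣<∣T∣ : ∣ S ℤ.* S ℤ.* W ∣ < ∣ T ∣
    ∣S²W∣<∣T∣ = +-cancelʳ-< (2 * A) _ _ (begin-strict
      ∣ S ℤ.* S ℤ.* W ∣ + 2 * A                                  ≤⟨ +-monoˡ-≤ (2 * A) ∣S²W∣≤ ⟩
      s * s * (A * (288 * x) + s * (274 * A + s * s * s)) + 2 * A <⟨ s²W-estimate 50sA≤x ⟩
      12 * (s * x * (x + s))                                      ≤⟨ ∣T∣≥ ⟩
      ∣ T ∣ + 2 * A                                               ∎)

    ∣R∣<∣Q∣ : ∣ R ∣ < ∣ Q ∣
    ∣R∣<∣Q∣ = +-cancelʳ-< ∣ Qerr ∣ _ _ (begin-strict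
      ∣ R ∣ + ∣ Qerr ∣
        ≤⟨ +-monoˡ-≤ ∣ Qerr ∣ (∣i+j∣≤∣i∣+∣j∣ (D ℤ.* T) (S ℤ.* S ℤ.* W)) ⟩
      ∣ D ℤ.* T ∣ + ∣ S ℤ.* S ℤ.* W ∣ + ∣ Qerr ∣
        <⟨ +-mono-<-≤ (+-mono-≤-< ∣DT∣≤ ∣S²W∣<12sxy) ∣Qerr∣≤ ⟩
      (32 * A + s * s * s) * (12 * (s * x * (x + s)) + 2 * A) + 12 * (s * x * (x + s))
        + (8 * (x * x * s) + 6 * (x * s * s) + s * s * s + 8 * A)
        ≤⟨ residual-estimate 50sA≤x ⟩
      16 * (x * x * (x + s))
        ≤⟨ ∣Q∣≥ ⟩
      ∣ Q ∣ + ∣ Qerr ∣ ∎)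
      where
      ∣DT∣≤ : ∣ D ℤ.* T ∣ ≤ (32 * A + s * s * s) * (12 * (s * x * (x + s)) + 2 * A)
      ∣DT∣≤ = ≤-trans (≤-reflexive (abs-* D T)) (*-mono-≤ ∣D∣≤ ∣T∣≤)
      ∣S²W∣<12sxy : ∣ S ℤ.* S ℤ.* W ∣ < 12 * (s * x * (x + s))
      ∣S²W∣<12sxy = ≤-<-trans ∣S²W∣≤ (≤-<-trans (m≤m+n _ (2 * A)) (s²W-estimate 50sA≤x))

    ∣SV∣<∣288X∣ : ∣ S ℤ.* V ∣ < ∣ + 288 ℤ.* X ∣
    ∣SV∣<∣288X∣ = subst (∣ S ℤ.* V ∣ <_) (sym (abs-* (+ 288) X)) (≤-<-trans ∣SV∣≤ (sV-estimate 50sA≤x))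

    324s⁴≢0 : 324 * (s * s * s * s) ≢ 0
    324s⁴≢0 = ≢-nonZero⁻¹ _ {{m*n≢0 324 _ {{_}} {{m*n≢0 (s * s * s) s {{m*n≢0 (s * s) s {{m*n≢0 s s}}}}}}}}

    no-near-cube-pair : ∀ M → M ℤ.* M ≡ (X ℤ.* X ℤ.* X ℤ.- e) ℤ.* (Y ℤ.* Y ℤ.* Y ℤ.- f) → ⊥
    no-near-cube-pair M M²≡ = 324s⁴≢0 (begin-equality
      324 * (s * s * s * s)                  ≡⟨ ∣+324*S⁴∣ ⟨
      ∣ + 324 ℤ.* (S ℤ.* S ℤ.* S ℤ.* S) ∣    ≡⟨ cong ∣_∣ (324s⁴≡0 W≡0 E≡0 D≡0) ⟩
      0                                      ∎)
      where
      R≡0 : R ≡ 0ℤ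
      R≡0 = trans (R≡Q²-[16M]² M M²≡)
                  (∣i*i-j*j∣<∣i∣⇒i*i-j*j≡0 Q (+ 16 ℤ.* M) (subst (_< ∣ Q ∣) (cong ∣_∣ (R≡Q²-[16M]² M M²≡)) ∣R∣<∣Q∣))
      D≡0 : D ≡ 0ℤ
      D≡0 = i*j+k≡0⇒i≡0 D T (S ℤ.* S ℤ.* W) R≡0 ∣S²W∣<∣T∣
      W≡0 : W ≡ 0ℤ
      W≡0 = ℤᴾ.*-cancelˡ-≡ (S ℤ.* S) W 0ℤ {{i*j≢0 S S}} (trans (S²W≡0 R≡0 D≡0) (sym (ℤᴾ.*-zeroʳ (S ℤ.* S))))
      E≡0 : E ≡ 0ℤ
      E≡0 = i*j+k≡0⇒i≡0 E (+ 288 ℤ.* X) (S ℤ.* V) W≡0 ∣SV∣<∣288X∣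
      ∣+324*S⁴∣ : ∣ + 324 ℤ.* (S ℤ.* S ℤ.* S ℤ.* S) ∣ ≡ 324 * (s * s * s * s)
      ∣+324*S⁴∣ = trans (abs-* (+ 324) (S ℤ.* S ℤ.* S ℤ.* S))
                        (cong (324 *_) (trans (abs-* (S ℤ.* S ℤ.* S) S) (cong (_* s) (∣+m*+n*+o∣ s s s))))

open import Data.Nat using (_+_; _*_; _^_; _∸_)
open import Data.Nat.Properties using (≤-trans; <⇒≤; <-≤-trans; ≤-reflexive; +-comm; +-monoʳ-≤; +-cancelʳ-<; m≤m+n; m≤n*m; m∸n+n≡m)
open import Data.Nat.Tactic.RingSolver using (solve-∀)

[5s]⁶≡15625s⁶ : ∀ s → (5 * s) ^ 6 ≡ 15625 * (s * s * s * s * s * s)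
[5s]⁶≡15625s⁶ s = unfolded s
  where
  unfolded : ∀ s → 5 * s * (5 * s * (5 * s * (5 * s * (5 * s * (5 * s * 1))))) ≡ 15625 * (s * s * s * s * s * s)
  unfolded = solve-∀

s≤[5s]⁶ : ∀ {s} → 1 ≤ s → s ≤ (5 * s) ^ 6
s≤[5s]⁶ {s} 1≤s = ≤-trans (Powers.s≤s⁶ 1≤s) (≤-trans (m≤n*m _ 15625) (≤-reflexive (sym ([5s]⁶≡15625s⁶ s))))

15624s⁶≤z : ∀ {z s} → 1 ≤ s → (5 * s) ^ 6 < z + s → 15624 * (s * s * s * s * s * s) ≤ z
15624s⁶≤z {z} {s} 1≤s [5s]⁶<z+s = <⇒≤ (+-cancelʳ-< s⁶ (15624 * s⁶) z (begin-strict
  15624 * s⁶ + s⁶   ≡⟨ +-comm (15624 * s⁶) s⁶ ⟩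
  15625 * s⁶        ≡⟨ [5s]⁶≡15625s⁶ s ⟨
  (5 * s) ^ 6       <⟨ [5s]⁶<z+s ⟩
  z + s             ≤⟨ +-monoʳ-≤ z (Powers.s≤s⁶ 1≤s) ⟩
  z + s⁶            ∎))
  where
  open Data.Nat.Properties.≤-Reasoning
  s⁶ = s * s * s * s * s * s

no-close-pair : ∀ {z s} → 1 ≤ s → (5 * s) ^ 6 < z + s → CubeNearSquare z → ¬ CubeNearSquare (z + s)
no-close-pair {z} {s} 1≤s [5s]⁶<z+s (m , e , e²<z , m²≡) (n , f , f²<z+s , n²≡) =
  NearCubePair.no-near-cube-pair z s e f 1≤s (15624s⁶≤z 1≤s [5s]⁶<z+s) e²<z f²<z+s
    (+ m ℤ.* + n) (trans (interchange (+ m) (+ n)) (cong₂ ℤ._*_ m²≡ n²≡))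
  where
  interchange : ∀ a b → a ℤ.* b ℤ.* (a ℤ.* b) ≡ a ℤ.* a ℤ.* (b ℤ.* b)
  interchange = Data.Integer.Tactic.RingSolver.solve-∀
    where import Data.Integer.Tactic.RingSolver

theorem1 : (x s : ℕ) → IsHall x → 1 ≤ s → (5 * s) ^ 6 < x →
    ¬ IsHall (x + s) × ¬ IsHall (x ∸ s)
theorem1 x s hall-x 1≤s [5s]⁶<x =
    (λ hall-x+s → no-close-pair 1≤s (<-≤-trans [5s]⁶<x (m≤m+n x s))
                                (Hall⇒cube-near-square hall-x) (Hall⇒cube-near-square hall-x+s))
  , (λ hall-x∸s → no-close-pair 1≤s (subst ((5 * s) ^ 6 <_) (sym x∸s+s≡x) [5s]⁶<x)
                                (Hall⇒cube-near-square hall-x∸s)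
                                (Hall⇒cube-near-square (subst IsHall (sym x∸s+s≡x) hall-x)))
  where
  x∸s+s≡x : x ∸ s + s ≡ x
  x∸s+s≡x = m∸n+n≡m (≤-trans (s≤[5s]⁶ 1≤s) (<⇒≤ [5s]⁶<x))
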